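{- Let $N,k\in\mathbb{N}$ and let $r$ be an odd prime with $\gcd(Nk,r)=1$. Then \[ |\mathcal{L}_{N,r,k}|=\frac{r+(k^{ -1}N\,|\,r)}{2}, \] where $(\cdot|\cdot)$ is the Legendre symbol and $k^{ -1}$ is the inverse of $k$ modulo $r$.
   Context: $\mathcal{H}_{N,m}:=\{(x,y)\in(\mathbb{Z}/m\mathbb{Z})^2: xy\equiv N \bmod m\}$ and, for $\gcd(Nk,m)=1$, $\mathcal{L}_{N,m,k}:=\{kx+y\bmod m:(x,y)\in\mathcal{H}_{N,m}\}$. -}

module Defs where

open import Data.Nat using (ℕ; zero; suc; _+_; _*_; _≡ᵇ_; NonZero)
open import Data.Nat.DivMod using (_%_)
open import Data.Bool using (Bool; true; false; if_then_else_; _∧_)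
open import Data.List using (List; length; filterᵇ; upTo)
open import Data.Bool.ListAction using (any)
open import Data.Integer using (ℤ; +_; -[1+_])

-- Residues mod m are represented by the naturals 0, …, m-1.

inH : (N m : ℕ) .{{_ : NonZero m}} → ℕ → ℕ → Bool
inH N m x y = ((x * y) % m) ≡ᵇ (N % m)

inL : (N m k : ℕ) .{{_ : NonZero m}} → ℕ → Bool
inL N m k z =
  any (λ x → any (λ y → inH N m x y ∧ (((k * x + y) % m) ≡ᵇ z)) (upTo m)) (upTo m)

Lset : (N m k : ℕ) .{{_ : NonZero m}} → List ℕ
Lset N m k = filterᵇ (inL N m k) (upTo m)

cardL : (N m k : ℕ) .{{_ : NonZero m}} → ℕ
cardL N m k = length (Lset N m k)

isSquareMod : (a p : ℕ) .{{_ : NonZero p}} → Bool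
isSquareMod a p = any (λ t → ((t * t) % p) ≡ᵇ (a % p)) (upTo p)

legendre : (a p : ℕ) .{{_ : NonZero p}} → ℤ
legendre a p =
  if (a % p) ≡ᵇ 0 then + 0
  else if isSquareMod a p then + 1
  else -[1+ 0 ]

module Submission where

-- For x ≢ 0 (mod r) the only point of H_{N,r} over x is (x, N/x), and every point of H has
-- x ≢ 0, so L_{N,r,k} is the image of g(x) = k x + N/x on the r − 1 nonzero residues.
-- Since k a + N/a ≡ k b + N/b iff (a − b)(k − N/(a b)) ≡ 0, the fibres of g are exactly the
-- orbits of the involution σ(x) = k⁻¹N/x. Counting orbits, 2 |L| = (r − 1) + #{x : σ x ≡ x},
-- and the fixed points of σ are the square roots of k⁻¹N, of which there are 1 + (k⁻¹N | r).

open import Defs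
open import Data.Bool using (Bool; true; false; T; not; _∧_; if_then_else_)
open import Data.Bool.ListAction using (any)
open import Data.Bool.Properties using (T-≡; T-∧; ∧-assoc; ∧-idem; ∧-zeroʳ; ∧-identityʳ)
open import Data.Empty using (⊥-elim)
open import Data.Integer using (+_; -[1+_]) renaming (_+_ to _+ℤ_; _*_ to _*ℤ_)
import Data.Integer.Properties as ℤ
open import Data.Integer.Properties using (pos-+; pos-*)
open import Data.List using ([]; _∷_; [_]; _++_; length; filterᵇ; upTo)
open import Data.List.Membership.Propositional using (find; lose)
open import Data.List.Membership.Propositional.Properties using (∈-upTo⁺; ∈-upTo⁻)
open import Data.List.Properties using (upTo-∷ʳ; length-++; filter-++)
open import Data.List.Relation.Unary.Any.Properties using (any⁺; any⁻)
open import Data.Nat using (ℕ; zero; suc; pred; _+_; _∸_; _*_; _%_; _<_; _≤_; _≡ᵇ_; _≟_; s≤s⁻¹;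
  NonZero; >-nonZero⁻¹; ≢-nonZero; nonTrivial⇒n>1)
open import Data.Nat.Coprimality using (Coprime; prime⇒coprime; coprime-Bézout)
open import Data.Nat.DivMod
open import Data.Nat.Divisibility using (_∣_; divides; ∣-refl; ∣m⇒∣m*n; m%n≡0⇒n∣m; n∣m⇒m%n≡0)
open import Data.Nat.GCD using (module Bézout)
open import Data.Nat.Primality using (Prime; euclidsLemma; prime⇒irreducible; prime⇒nonTrivial)
open import Data.Nat.Properties
open import Data.Nat.Tactic.RingSolver using (solve)
open import Data.Product using (∃-syntax; _×_; _,_; proj₁; proj₂; map₁; map₂)
open import Data.Sum using (_⊎_; inj₁; inj₂; [_,_]′)
import Data.Sum as Sum
open import Function using (id; _∘_; Equivalence)
open import Relation.Binary.PropositionalEquality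
  using (_≡_; _≢_; refl; sym; trans; cong; cong₂; subst; module ≡-Reasoning)
open import Relation.Nullary using (¬_; yes; no; contradiction)
open import Relation.Nullary.Decidable using (T?)

T⇒≡true : ∀ {b} → T b → b ≡ true
T⇒≡true = Equivalence.to T-≡

T-injective : ∀ {a b} → (T a → T b) → (T b → T a) → a ≡ b
T-injective {false} {false} _ _ = refl
T-injective {false} {true}  _ f = ⊥-elim (f _)
T-injective {true}  {false} f _ = ⊥-elim (f _)
T-injective {true}  {true}  _ _ = refl

any-upTo⁺ : ∀ f {n i} → i < n → T (f i) → T (any f (upTo n))
any-upTo⁺ f i<n fi = any⁺ f (lose (∈-upTo⁺ i<n) fi)

any-upTo⁻ : ∀ f {n} → T (any f (upTo n)) → ∃[ i ] i < n × T (f i)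
any-upTo⁻ f {n} t with i , i∈ , fi ← find (any⁻ f (upTo n) t) = i , ∈-upTo⁻ i∈ , fi

count : (ℕ → Bool) → ℕ → ℕ
count P zero    = 0
count P (suc n) = if P n then suc (count P n) else count P n

length-filterᵇ-upTo : ∀ P n → length (filterᵇ P (upTo n)) ≡ count P n
length-filterᵇ-upTo P zero    = refl
length-filterᵇ-upTo P (suc n) = begin
  length (filterᵇ P (upTo (suc n)))
    ≡⟨ cong (length ∘ filterᵇ P) (sym (upTo-∷ʳ n)) ⟩
  length (filterᵇ P (upTo n ++ [ n ]))
    ≡⟨ cong length (filter-++ (T? ∘ P) (upTo n) [ n ]) ⟩
  length (filterᵇ P (upTo n) ++ filterᵇ P [ n ])
    ≡⟨ length-++ (filterᵇ P (upTo n)) ⟩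
  length (filterᵇ P (upTo n)) + length (filterᵇ P [ n ])
    ≡⟨ cong (_+ length (filterᵇ P [ n ])) (length-filterᵇ-upTo P n) ⟩
  count P n + length (filterᵇ P [ n ])
    ≡⟨ last ⟩
  count P (suc n) ∎
  where
  open ≡-Reasoning
  last : count P n + length (filterᵇ P [ n ]) ≡ count P (suc n)
  last with P n
  ... | true  = +-comm (count P n) 1
  ... | false = +-identityʳ (count P n)

count-cong : ∀ {P Q} n → (∀ {i} → i < n → P i ≡ Q i) → count P n ≡ count Q n
count-cong zero    _  = refl
count-cong (suc n) eq =
  cong₂ (λ b c → if b then suc c else c) (eq (n<1+n n)) (count-cong n (eq ∘ m<n⇒m<1+n))

count-none : ∀ {P} n → (∀ {i} → i < n → ¬ T (P i)) → count P n ≡ 0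
count-none         zero    _    = refl
count-none {P = P} (suc n) none with P n in Pn
... | true  = ⊥-elim (none (n<1+n n) (subst T (sym Pn) _))
... | false = count-none n (none ∘ m<n⇒m<1+n)

infixl 6 _∖_
_∖_ : (ℕ → Bool) → ℕ → ℕ → Bool
(P ∖ a) i = P i ∧ not (i ≡ᵇ a)

∖-self : ∀ P a → (P ∖ a) a ≡ false
∖-self P a rewrite T⇒≡true (≡⇒≡ᵇ a a refl) = ∧-zeroʳ (P a)

∖-≢ : ∀ P {a i} → i ≢ a → (P ∖ a) i ≡ P i
∖-≢ P {a} {i} i≢a with i ≡ᵇ a in eq
... | true  = ⊥-elim (i≢a (≡ᵇ⇒≡ i a (subst T (sym eq) _)))
... | false = ∧-identityʳ (P i)

∖⁺ : ∀ P {a i} → T (P i) → i ≢ a → T ((P ∖ a) i)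
∖⁺ P Pi i≢a = subst T (sym (∖-≢ P i≢a)) Pi

∖⁻ : ∀ P {a i} → T ((P ∖ a) i) → T (P i) × i ≢ a
∖⁻ P {a} {i} t with i ≟ a
... | yes refl = ⊥-elim (subst T (∖-self P i) t)
... | no  i≢a  = subst T (∖-≢ P i≢a) t , i≢a

count-∖ : ∀ {P} n {a} → a < n → T (P a) → count P n ≡ suc (count (P ∖ a) n)
count-∖ {P} (suc n) a<1+n Pa with m<1+n⇒m<n∨m≡n a<1+n
... | inj₂ refl rewrite ∖-self P n | T⇒≡true Pa =
  cong suc (sym (count-cong n (λ i<n → ∖-≢ P (<⇒≢ i<n))))
... | inj₁ a<n rewrite ∖-≢ P {i = n} (λ n≡a → <-irrefl (sym n≡a) a<n) with P n
...   | true  = cong suc (count-∖ n a<n Pa)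
...   | false = count-∖ n a<n Pa

count-pair : ∀ {P} n {a b} → a < n → b < n → a ≢ b → T (P a) → T (P b) →
             (∀ {i} → i < n → T (P i) → i ≡ a ⊎ i ≡ b) → count P n ≡ 2
count-pair {P} n a<n b<n a≢b Pa Pb only =
  trans (count-∖ n a<n Pa) (cong suc
    (trans (count-∖ n b<n (∖⁺ P Pb (a≢b ∘ sym))) (cong suc (count-none n none))))
  where
  none : ∀ {i} → i < n → ¬ T ((P ∖ _ ∖ _) i)
  none i<n t with t′ , i≢b ← ∖⁻ (P ∖ _) t with Pi , i≢a ← ∖⁻ P t′ =
    [ i≢a , i≢b ]′ (only i<n Pi)

search : (ℕ → Bool) → ℕ → ℕ
search f zero    = 0
search f (suc n) = if f n then n else search f n

search-correct : ∀ f {n i} → i < n → T (f i) → search f n < n × T (f (search f n))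
search-correct f {suc n} {i} i<1+n fi with f n in fn
... | true  = n<1+n n , subst T (sym fn) _
... | false with m<1+n⇒m<n∨m≡n i<1+n
...   | inj₁ i<n  = map₁ m<n⇒m<1+n (search-correct f i<n fi)
...   | inj₂ refl = ⊥-elim (subst T fn fi)

nonzero : ℕ → Bool
nonzero x = not (x ≡ᵇ 0)

count-nonzero : ∀ n → count nonzero (suc n) ≡ n
count-nonzero zero    = refl
count-nonzero (suc n) = cong suc (count-nonzero n)

module Orbits (n m : ℕ) (σ g : ℕ → ℕ) where

  record IsOrbitPartition (P : ℕ → Bool) : Set where
    field
      σ-<          : ∀ {a} → a < n → T (P a) → σ a < n
      σ-closed     : ∀ {a} → a < n → T (P a) → T (P (σ a))
      σ-involutive : ∀ {a} → a < n → T (P a) → σ (σ a) ≡ a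
      g-<          : ∀ {a} → a < n → T (P a) → g a < m
      g∘σ          : ∀ {a} → a < n → T (P a) → g (σ a) ≡ g a
      g-fibre      : ∀ {a b} → a < n → b < n → T (P a) → T (P b) → g a ≡ g b → b ≡ a ⊎ b ≡ σ a

  image : (ℕ → Bool) → ℕ → Bool
  image P z = any (λ a → P a ∧ (g a ≡ᵇ z)) (upTo n)

  fixed : (ℕ → Bool) → ℕ → Bool
  fixed P a = (σ a ≡ᵇ a) ∧ P a

  image⁺ : ∀ P {a z} → a < n → T (P a) → g a ≡ z → T (image P z)
  image⁺ P {a} a<n Pa refl =
    any-upTo⁺ _ a<n (Equivalence.from T-∧ (Pa , ≡⇒≡ᵇ (g a) (g a) refl))

  image⁻ : ∀ P {z} → T (image P z) → ∃[ a ] a < n × T (P a) × g a ≡ z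
  image⁻ P {z} t with a , a<n , t′ ← any-upTo⁻ _ t with Pa , ga≡z ← Equivalence.to T-∧ t′ =
    a , a<n , Pa , ≡ᵇ⇒≡ (g a) z ga≡z

  fixed⁺ : ∀ P {a} → T (P a) → σ a ≡ a → T (fixed P a)
  fixed⁺ P {a} Pa σa≡a = Equivalence.from T-∧ (≡⇒≡ᵇ (σ a) a σa≡a , Pa)

  fixed⁻ : ∀ P {a} → T (fixed P a) → T (P a) × σ a ≡ a
  fixed⁻ P {a} t with σa≡a , Pa ← Equivalence.to T-∧ t = Pa , ≡ᵇ⇒≡ (σ a) a σa≡a

  fixed-∖ : ∀ P a {i} → fixed (P ∖ a) i ≡ (fixed P ∖ a) i
  fixed-∖ P a {i} = sym (∧-assoc (σ i ≡ᵇ i) (P i) _)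

  _∖orbit_ : (ℕ → Bool) → ℕ → ℕ → Bool
  P ∖orbit a = P ∖ a ∖ σ a

  ∖orbit⁺ : ∀ P {a i} → T (P i) → i ≢ a → i ≢ σ a → T ((P ∖orbit a) i)
  ∖orbit⁺ P Pi i≢a i≢σa = ∖⁺ (P ∖ _) (∖⁺ P Pi i≢a) i≢σa

  ∖orbit⁻ : ∀ P {a i} → T ((P ∖orbit a) i) → T (P i) × i ≢ a × i ≢ σ a
  ∖orbit⁻ P t with t′ , i≢σa ← ∖⁻ (P ∖ _) t with Pi , i≢a ← ∖⁻ P t′ = Pi , i≢a , i≢σa

  module _ {P : ℕ → Bool} (O : IsOrbitPartition P) {a : ℕ} (a<n : a < n) (Pa : T (P a)) where
    open IsOrbitPartition O

    ∖orbit-isOrbitPartition : IsOrbitPartition (P ∖orbit a)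
    ∖orbit-isOrbitPartition = record
      { σ-<          = λ b<n → σ-< b<n ∘ proj₁ ∘ ∖orbit⁻ P
      ; σ-closed     = closed
      ; σ-involutive = λ b<n → σ-involutive b<n ∘ proj₁ ∘ ∖orbit⁻ P
      ; g-<          = λ b<n → g-< b<n ∘ proj₁ ∘ ∖orbit⁻ P
      ; g∘σ          = λ b<n → g∘σ b<n ∘ proj₁ ∘ ∖orbit⁻ P
      ; g-fibre      = λ b<n c<n Qb Qc → g-fibre b<n c<n (proj₁ (∖orbit⁻ P Qb)) (proj₁ (∖orbit⁻ P Qc))
      }
      where
      closed : ∀ {b} → b < n → T ((P ∖orbit a) b) → T ((P ∖orbit a) (σ b))
      closed {b} b<n Qb with Pb , b≢a , b≢σa ← ∖orbit⁻ P Qb = ∖orbit⁺ P (σ-closed b<n Pb)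
        (λ σb≡a  → b≢σa (trans (sym (σ-involutive b<n Pb)) (cong σ σb≡a)))
        (λ σb≡σa → b≢a (begin
          b         ≡⟨ sym (σ-involutive b<n Pb) ⟩
          σ (σ b)   ≡⟨ cong σ σb≡σa ⟩
          σ (σ a)   ≡⟨ σ-involutive a<n Pa ⟩
          a         ∎))
        where open ≡-Reasoning

    image-∖orbit : ∀ {z} → image (P ∖orbit a) z ≡ (image P ∖ g a) z
    image-∖orbit {z} = T-injective to from
      where
      to : T (image (P ∖orbit a) z) → T ((image P ∖ g a) z)
      to t with b , b<n , Qb , gb≡z ← image⁻ (P ∖orbit a) t with Pb , b≢a , b≢σa ← ∖orbit⁻ P Qb =
        ∖⁺ (image P) (image⁺ P b<n Pb gb≡z) λ z≡ga →
          [ b≢a , b≢σa ]′ (g-fibre a<n b<n Pa Pb (sym (trans gb≡z z≡ga)))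
      from : T ((image P ∖ g a) z) → T (image (P ∖orbit a) z)
      from t with t′ , z≢ga ← ∖⁻ (image P) t with b , b<n , Pb , gb≡z ← image⁻ P t′ =
        image⁺ (P ∖orbit a) b<n
          (∖orbit⁺ P Pb (λ b≡a → z≢ga (trans (sym gb≡z) (cong g b≡a)))
                        (λ b≡σa → z≢ga (trans (sym gb≡z) (trans (cong g b≡σa) (g∘σ a<n Pa)))))
          gb≡z

    I′ C′ F′ : ℕ
    I′ = count (image (P ∖orbit a)) m
    C′ = count (P ∖orbit a) n
    F′ = count (fixed (P ∖orbit a)) n

    count-image : count (image P) m ≡ suc I′
    count-image = trans (count-∖ m (g-< a<n Pa) (image⁺ P a<n Pa refl))
                        (cong suc (sym (count-cong m (λ _ → image-∖orbit))))

    module _ (σa≡a : σ a ≡ a) where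

      ∖orbit-singleton : ∀ {i} → (P ∖orbit a) i ≡ (P ∖ a) i
      ∖orbit-singleton {i} = begin
        (P ∖ a ∖ σ a) i              ≡⟨ cong (λ x → (P ∖ a ∖ x) i) σa≡a ⟩
        (P i ∧ not (i ≡ᵇ a)) ∧ not (i ≡ᵇ a) ≡⟨ ∧-assoc (P i) _ _ ⟩
        P i ∧ (not (i ≡ᵇ a) ∧ not (i ≡ᵇ a)) ≡⟨ cong (P i ∧_) (∧-idem _) ⟩
        (P ∖ a) i                    ∎
        where open ≡-Reasoning

      count-singletonOrbit : count P n ≡ suc C′
      count-singletonOrbit =
        trans (count-∖ n a<n Pa) (cong suc (sym (count-cong n (λ _ → ∖orbit-singleton))))

      count-fixed-singletonOrbit : count (fixed P) n ≡ suc F′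
      count-fixed-singletonOrbit = trans (count-∖ n a<n (fixed⁺ P Pa σa≡a)) (cong suc (sym
        (count-cong n λ {i} _ → trans (cong ((σ i ≡ᵇ i) ∧_) ∖orbit-singleton) (fixed-∖ P a))))

    module _ (σa≢a : σ a ≢ a) where

      count-pairOrbit : count P n ≡ 2 + C′
      count-pairOrbit = trans (count-∖ n a<n Pa)
        (cong suc (count-∖ n (σ-< a<n Pa) (∖⁺ P (σ-closed a<n Pa) σa≢a)))

      count-fixed-pairOrbit : count (fixed P) n ≡ F′
      count-fixed-pairOrbit = count-cong n λ _ → T-injective to from
        where
        to : ∀ {i} → T (fixed P i) → T (fixed (P ∖orbit a) i)
        to {i} t with Pi , σi≡i ← fixed⁻ P t = fixed⁺ (P ∖orbit a) (∖orbit⁺ P {a} Pi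
          (λ { refl → σa≢a σi≡i })
          (λ { refl → σa≢a (trans (sym σi≡i) (σ-involutive a<n Pa)) }))
          σi≡i
        from : ∀ {i} → T (fixed (P ∖orbit a) i) → T (fixed P i)
        from t with Qi , σi≡i ← fixed⁻ (P ∖orbit a) t = fixed⁺ P (proj₁ (∖orbit⁻ P Qi)) σi≡i

    count-∖orbit-< : C′ < count P n
    count-∖orbit-< with σ a ≟ a
    ... | yes σa≡a = ≤-reflexive (sym (count-singletonOrbit σa≡a))
    ... | no  σa≢a = ≤-trans (n≤1+n _) (≤-reflexive (sym (count-pairOrbit σa≢a)))

    orbit-step : 2 * I′ ≡ C′ + F′ → 2 * count (image P) m ≡ count P n + count (fixed P) n
    orbit-step ih with σ a ≟ a
    ... | yes σa≡a = begin
      2 * count (image P) m          ≡⟨ cong (2 *_) count-image ⟩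
      2 * suc I′                     ≡⟨ *-suc 2 I′ ⟩
      2 + 2 * I′                     ≡⟨ cong (suc ∘ suc) ih ⟩
      2 + (C′ + F′)                  ≡⟨ cong suc (sym (+-suc C′ F′)) ⟩
      suc C′ + suc F′                ≡⟨ sym (cong₂ _+_ (count-singletonOrbit σa≡a)
                                                        (count-fixed-singletonOrbit σa≡a)) ⟩
      count P n + count (fixed P) n  ∎
      where open ≡-Reasoning
    ... | no σa≢a = begin
      2 * count (image P) m          ≡⟨ cong (2 *_) count-image ⟩
      2 * suc I′                     ≡⟨ *-suc 2 I′ ⟩
      2 + 2 * I′                     ≡⟨ cong (suc ∘ suc) ih ⟩
      2 + C′ + F′                    ≡⟨ sym (cong₂ _+_ (count-pairOrbit σa≢a) (count-fixed-pairOrbit σa≢a)) ⟩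
      count P n + count (fixed P) n  ∎
      where open ≡-Reasoning

  orbit-count : ∀ {P} → IsOrbitPartition P → 2 * count (image P) m ≡ count P n + count (fixed P) n
  orbit-count {P} O = go (count P n) O ≤-refl
    where
    go : ∀ k {P} → IsOrbitPartition P → count P n ≤ k →
         2 * count (image P) m ≡ count P n + count (fixed P) n
    go k {P} O P≤k with T? (any P (upTo n))
    ... | no ¬any = begin
      2 * count (image P) m          ≡⟨ cong (2 *_) (count-none m no-image) ⟩
      0                              ≡⟨ sym (cong₂ _+_ (count-none n none) (count-none n no-fixed)) ⟩
      count P n + count (fixed P) n  ∎
      where
      open ≡-Reasoning
      none : ∀ {a} → a < n → ¬ T (P a)
      none a<n Pa = ¬any (any-upTo⁺ P a<n Pa)
      no-image : ∀ {z} → z < m → ¬ T (image P z)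
      no-image _ t with a , a<n , Pa , _ ← image⁻ P t = none a<n Pa
      no-fixed : ∀ {a} → a < n → ¬ T (fixed P a)
      no-fixed a<n = none a<n ∘ proj₁ ∘ fixed⁻ P
    ... | yes anyP with a , a<n , Pa ← any-upTo⁻ P anyP = step k P≤k
      where
      shrinks : count (P ∖orbit a) n < count P n
      shrinks = count-∖orbit-< O a<n Pa
      step : ∀ k → count P n ≤ k → 2 * count (image P) m ≡ count P n + count (fixed P) n
      step zero    P≤0 = contradiction (≤-trans shrinks P≤0) λ ()
      step (suc k) P≤k =
        orbit-step O a<n Pa (go k (∖orbit-isOrbitPartition O a<n Pa) (s≤s⁻¹ (≤-trans shrinks P≤k)))

module Residues (r : ℕ) .{{_ : NonZero r}} where

  infix 4 _≈_
  _≈_ : ℕ → ℕ → Set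
  a ≈ b = a % r ≡ b % r

  %-≈ : ∀ a → a % r ≈ a
  %-≈ a = m%n%n≡m%n a r

  ≈⇒≡ : ∀ {a b} → a < r → b < r → a ≈ b → a ≡ b
  ≈⇒≡ a<r b<r eq = trans (sym (m<n⇒m%n≡m a<r)) (trans eq (m<n⇒m%n≡m b<r))

  ≡⇒≈ : ∀ {a b} → a ≡ b → a ≈ b
  ≡⇒≈ = cong (_% r)

  +-cong : ∀ {a b c d} → a ≈ b → c ≈ d → a + c ≈ b + d
  +-cong {a} {b} {c} {d} a≈b c≈d = begin
    (a + c) % r             ≡⟨ %-distribˡ-+ a c r ⟩
    (a % r + c % r) % r     ≡⟨ cong₂ (λ x y → (x + y) % r) a≈b c≈d ⟩
    (b % r + d % r) % r     ≡⟨ sym (%-distribˡ-+ b d r) ⟩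
    (b + d) % r             ∎
    where open ≡-Reasoning

  *-cong : ∀ {a b c d} → a ≈ b → c ≈ d → a * c ≈ b * d
  *-cong {a} {b} {c} {d} a≈b c≈d = begin
    (a * c) % r             ≡⟨ %-distribˡ-* a c r ⟩
    (a % r * (c % r)) % r   ≡⟨ cong₂ (λ x y → (x * y) % r) a≈b c≈d ⟩
    (b % r * (d % r)) % r   ≡⟨ sym (%-distribˡ-* b d r) ⟩
    (b * d) % r             ∎
    where open ≡-Reasoning

  0%r≡0 : 0 % r ≡ 0
  0%r≡0 = m<n⇒m%n≡m (>-nonZero⁻¹ r)

  *r≈0 : ∀ a → a * r ≈ 0
  *r≈0 a = trans (m*n%n≡0 a r) (sym 0%r≡0)

  nonzero⁺ : ∀ {x} → ¬ x ≈ 0 → T (nonzero x)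
  nonzero⁺ {zero}  x≉0 = x≉0 refl
  nonzero⁺ {suc x} _   = _

  nonzero⁻ : ∀ {x} → x < r → T (nonzero x) → ¬ x ≈ 0
  nonzero⁻ x<r nz x≈0 with refl ← ≈⇒≡ x<r (>-nonZero⁻¹ r) x≈0 = nz

  +-identityʳ-≈ : ∀ a {b} → b ≈ 0 → a + b ≈ a
  +-identityʳ-≈ a b≈0 = trans (+-cong {a} refl b≈0) (≡⇒≈ (+-identityʳ a))

  -- c * pred r is an additive inverse of c.
  +-cancelʳ-≈ : ∀ {a b} c → a + c ≈ b + c → a ≈ b
  +-cancelʳ-≈ {a} {b} c eq = begin
    a % r                         ≡⟨ sym ([m+kn]%n≡m%n a c r) ⟩
    (a + c * r) % r               ≡⟨ ≡⇒≈ (complete a) ⟩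
    (a + c + c * pred r) % r      ≡⟨ +-cong eq refl ⟩
    (b + c + c * pred r) % r      ≡⟨ ≡⇒≈ (sym (complete b)) ⟩
    (b + c * r) % r               ≡⟨ [m+kn]%n≡m%n b c r ⟩
    b % r                         ∎
    where
    open ≡-Reasoning
    complete : ∀ x → x + c * r ≡ x + c + c * pred r
    complete x = begin
      x + c * r                   ≡⟨ cong (λ s → x + c * s) (sym (suc-pred r)) ⟩
      x + c * suc (pred r)        ≡⟨ cong (_+_ x) (*-suc c (pred r)) ⟩
      x + (c + c * pred r)        ≡⟨ sym (+-assoc x c _) ⟩
      x + c + c * pred r          ∎

module PrimeResidues (r : ℕ) .{{_ : NonZero r}} (r-prime : Prime r) where

  open Residues r public

  1<r : 1 < r
  1<r = nonTrivial⇒n>1 r {{prime⇒nonTrivial r-prime}}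

  1≉0 : ¬ 1 ≈ 0
  1≉0 1≈0 with () ← trans (sym (m<n⇒m%n≡m 1<r)) (trans 1≈0 0%r≡0)

  ≈0⇒∣ : ∀ {a} → a ≈ 0 → r ∣ a
  ≈0⇒∣ {a} a≈0 = m%n≡0⇒n∣m a r (trans a≈0 0%r≡0)

  *≈0⇒ : ∀ a b → a * b ≈ 0 → a ≈ 0 ⊎ b ≈ 0
  *≈0⇒ a b ab≈0 = Sum.map ∣⇒≈0 ∣⇒≈0 (euclidsLemma a b r-prime (≈0⇒∣ ab≈0))
    where
    ∣⇒≈0 : ∀ {x} → r ∣ x → x ≈ 0
    ∣⇒≈0 {x} r∣x = trans (n∣m⇒m%n≡0 x r r∣x) (sym 0%r≡0)

  *-cancelˡ-≈ : ∀ u {c d} → u * c ≈ u * d → u ≈ 0 ⊎ c ≈ d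
  *-cancelˡ-≈ u {c} {d} eq =
    [ (λ c≤d → cancel-≤ c≤d eq) , (λ d≤c → Sum.map₂ sym (cancel-≤ d≤c (sym eq))) ]′ (≤-total c d)
    where
    cancel-≤ : ∀ {c d} → c ≤ d → u * c ≈ u * d → u ≈ 0 ⊎ c ≈ d
    cancel-≤ {c} c≤d eq with v , refl ← m≤n⇒∃[o]m+o≡n c≤d =
      Sum.map₂ (sym ∘ +-identityʳ-≈ c) (*≈0⇒ u v (+-cancelʳ-≈ (u * c) uv+uc≈uc))
      where
      uv+uc≈uc : u * v + u * c ≈ u * c
      uv+uc≈uc = trans (≡⇒≈ (trans (+-comm (u * v) (u * c)) (sym (*-distribˡ-+ u c v)))) (sym eq)

  -- (a − b)(c − d) ≡ 0, with both sides moved so that no subtraction occurs.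
  ac+bd≈ad+bc⇒a≈b⊎c≈d : ∀ a b c d → a * c + b * d ≈ a * d + b * c → a ≈ b ⊎ c ≈ d
  ac+bd≈ad+bc⇒a≈b⊎c≈d a b c d eq =
    [ (λ a≤b → cross-≤ a≤b eq) , (λ b≤a → Sum.map₁ sym (cross-≤ b≤a eq′)) ]′ (≤-total a b)
    where
    eq′ : b * c + a * d ≈ b * d + a * c
    eq′ = trans (≡⇒≈ (+-comm (b * c) (a * d))) (trans (sym eq) (≡⇒≈ (+-comm (a * c) (b * d))))
    cross-≤ : ∀ {a b} → a ≤ b → a * c + b * d ≈ a * d + b * c → a ≈ b ⊎ c ≈ d
    cross-≤ {a} a≤b eq with u , refl ← m≤n⇒∃[o]m+o≡n a≤b =
      Sum.map (sym ∘ +-identityʳ-≈ a) sym (*-cancelˡ-≈ u (+-cancelʳ-≈ (a * c + a * d) ud≈uc))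
      where
      expandˡ : u * d + (a * c + a * d) ≡ a * c + (a + u) * d
      expandˡ = solve (u ∷ d ∷ a ∷ c ∷ [])
      expandʳ : a * d + (a + u) * c ≡ u * c + (a * c + a * d)
      expandʳ = solve (u ∷ d ∷ a ∷ c ∷ [])
      ud≈uc : u * d + (a * c + a * d) ≈ u * c + (a * c + a * d)
      ud≈uc = trans (≡⇒≈ expandˡ) (trans eq (≡⇒≈ expandʳ))

  -- Bézout gives b x ≡ ±1; for −1 the inverse is b (r − 1).
  invertible : ∀ {x} → ¬ x ≈ 0 → ∃[ u ] u * x ≈ 1
  invertible {x} x≉0 with coprime-Bézout (prime⇒coprime r-prime {{x%r≢0}} (m%n<n x r))
    where
    x%r≢0 : NonZero (x % r)
    x%r≢0 = ≢-nonZero λ x%r≡0 → x≉0 (trans x%r≡0 (sym 0%r≡0))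
  ... | Bézout.-+ a b eq = b , (begin
    (b * x) % r                    ≡⟨ *-cong {b} refl (sym (%-≈ x)) ⟩
    (b * (x % r)) % r              ≡⟨ ≡⇒≈ (sym eq) ⟩
    (1 + a * r) % r                ≡⟨ +-identityʳ-≈ 1 (*r≈0 a) ⟩
    1 % r                          ∎)
    where open ≡-Reasoning
  ... | Bézout.+- a b eq = b * pred r , +-cancelʳ-≈ (b * x) (begin
    (b * pred r * x + b * x) % r   ≡⟨ ≡⇒≈ (rearrange (pred r)) ⟩
    (b * x * suc (pred r)) % r     ≡⟨ ≡⇒≈ (cong (_*_ (b * x)) (suc-pred r)) ⟩
    (b * x * r) % r                ≡⟨ *r≈0 (b * x) ⟩
    0 % r                          ≡⟨ sym (*r≈0 a) ⟩
    (a * r) % r                    ≡⟨ ≡⇒≈ (sym eq) ⟩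
    (1 + b * (x % r)) % r          ≡⟨ +-cong {1} refl (*-cong {b} refl (%-≈ x)) ⟩
    (1 + b * x) % r                ∎)
    where
    open ≡-Reasoning
    rearrange : ∀ p → b * p * x + b * x ≡ b * x * suc p
    rearrange p = solve (b ∷ p ∷ x ∷ [])

  s+t≡r⇒s*s≈t*t : ∀ {s t} → s + t ≡ r → s * s ≈ t * t
  s+t≡r⇒s*s≈t*t {s} {t} s+t≡r = +-cancelʳ-≈ (s * t) (begin
    (s * s + s * t) % r   ≡⟨ ≡⇒≈ (sym (*-distribˡ-+ s s t)) ⟩
    (s * (s + t)) % r     ≡⟨ ≡⇒≈ (cong (_*_ s) s+t≡r) ⟩
    (s * r) % r           ≡⟨ trans (*r≈0 s) (sym (*r≈0 t)) ⟩
    (t * r) % r           ≡⟨ ≡⇒≈ (cong (_*_ t) (sym s+t≡r)) ⟩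
    (t * (s + t)) % r     ≡⟨ ≡⇒≈ expand ⟩
    (t * t + s * t) % r   ∎)
    where
    open ≡-Reasoning
    expand : t * (s + t) ≡ t * t + s * t
    expand = solve (s ∷ t ∷ [])

  s*s≈t*t⇒s≈t⊎s≈t′ : ∀ {s t t′} → t + t′ ≡ r → s * s ≈ t * t → s ≈ t ⊎ s ≈ t′
  s*s≈t*t⇒s≈t⊎s≈t′ {s} {t} {t′} t+t′≡r ss≈tt = ac+bd≈ad+bc⇒a≈b⊎c≈d s t s t′ (begin
    (s * s + t * t′) % r  ≡⟨ +-cong ss≈tt refl ⟩
    (t * t + t * t′) % r  ≡⟨ ≡⇒≈ (trans (sym (*-distribˡ-+ t t t′)) (cong (_*_ t) t+t′≡r)) ⟩
    (t * r) % r           ≡⟨ trans (*r≈0 t) (sym (*r≈0 s)) ⟩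
    (s * r) % r           ≡⟨ ≡⇒≈ (cong (_*_ s) (sym t+t′≡r)) ⟩
    (s * (t + t′)) % r    ≡⟨ ≡⇒≈ expand ⟩
    (s * t′ + t * s) % r  ∎)
    where
    open ≡-Reasoning
    expand : s * (t + t′) ≡ s * t′ + t * s
    expand = solve (s ∷ t ∷ t′ ∷ [])

  legendre-unit : ∀ {a} → ¬ a ≈ 0 → legendre a r ≡ (if isSquareMod a r then + 1 else -[1+ 0 ])
  legendre-unit {a} a≉0 with a % r ≡ᵇ 0 in eq
  ... | true  = ⊥-elim (a≉0 (trans (≡ᵇ⇒≡ (a % r) 0 (subst T (sym eq) _)) (sym 0%r≡0)))
  ... | false = refl

  t+t≢r : r ≢ 2 → ∀ t → t + t ≢ r
  t+t≢r r≢2 t t+t≡r with prime⇒irreducible r-prime (divides t (trans (sym t+t≡r) (solve (t ∷ []))))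
  ... | inj₂ 2≡r = r≢2 (sym 2≡r)

  root-count : r ≢ 2 → ∀ {a} → ¬ a ≈ 0 →
               + count (λ t → (t * t) % r ≡ᵇ a % r) r ≡ + 1 +ℤ legendre a r
  root-count r≢2 {a} a≉0 rewrite legendre-unit a≉0 with isSquareMod a r in square
  ... | false = cong +_ (count-none r λ t<r root → subst T square (any-upTo⁺ _ t<r root))
  ... | true with t , t<r , root ← any-upTo⁻ _ (subst T (sym square) _) =
    cong +_ (count-pair r t<r t′<r t≢t′ root root′ only)
    where
    t′ : ℕ
    t′ = r ∸ t
    tt≈a : t * t ≈ a
    tt≈a = ≡ᵇ⇒≡ _ _ root
    t+t′≡r : t + t′ ≡ r
    t+t′≡r = m+[n∸m]≡n (<⇒≤ t<r)
    t′<r : t′ < r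
    t′<r = ∸-monoʳ-< (n≢0⇒n>0 λ { refl → a≉0 (sym tt≈a) }) (<⇒≤ t<r)
    root′ : T ((t′ * t′) % r ≡ᵇ a % r)
    root′ = ≡⇒≡ᵇ _ _ (trans (s+t≡r⇒s*s≈t*t {t′} {t} (trans (+-comm t′ t) t+t′≡r)) tt≈a)
    t≢t′ : t ≢ t′
    t≢t′ t≡t′ = t+t≢r r≢2 t (trans (cong (_+_ t) t≡t′) t+t′≡r)
    only : ∀ {s} → s < r → T ((s * s) % r ≡ᵇ a % r) → s ≡ t ⊎ s ≡ t′
    only s<r root-s = Sum.map (≈⇒≡ s<r t<r) (≈⇒≡ s<r t′<r)
      (s*s≈t*t⇒s≈t⊎s≈t′ t+t′≡r (trans (≡ᵇ⇒≡ _ _ root-s) (sym tt≈a)))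

module Hyperbola (N k r kinv : ℕ) .{{_ : NonZero r}} (r-prime : Prime r)
                 (Nk-coprime : Coprime (N * k) r) (k*kinv%r≡1 : (k * kinv) % r ≡ 1) where

  open PrimeResidues r r-prime

  c : ℕ
  c = kinv * N

  N≉0 : ¬ N ≈ 0
  N≉0 N≈0 = >⇒≢ 1<r (Nk-coprime (∣m⇒∣m*n k (≈0⇒∣ N≈0) , ∣-refl))

  k*kinv≈1 : k * kinv ≈ 1
  k*kinv≈1 = trans k*kinv%r≡1 (sym (m<n⇒m%n≡m 1<r))

  c≉0 : ¬ c ≈ 0
  c≉0 c≈0 = [ kinv≉0 , N≉0 ]′ (*≈0⇒ kinv N c≈0)
    where
    kinv≉0 : ¬ kinv ≈ 0
    kinv≉0 kinv≈0 = 1≉0 (trans (sym k*kinv≈1) (trans (*-cong {k} refl kinv≈0) (≡⇒≈ (*-zeroʳ k))))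

  k*[kinv*x]≈x : ∀ x → k * (kinv * x) ≈ x
  k*[kinv*x]≈x x = begin
    (k * (kinv * x)) % r   ≡⟨ ≡⇒≈ (sym (*-assoc k kinv x)) ⟩
    (k * kinv * x) % r     ≡⟨ *-cong k*kinv≈1 refl ⟩
    (1 * x) % r            ≡⟨ ≡⇒≈ (*-identityˡ x) ⟩
    x % r                  ∎
    where open ≡-Reasoning

  kinv*[k*x]≈x : ∀ x → kinv * (k * x) ≈ x
  kinv*[k*x]≈x x = trans (≡⇒≈ swap) (k*[kinv*x]≈x x)
    where
    swap : kinv * (k * x) ≡ k * (kinv * x)
    swap = solve (kinv ∷ k ∷ x ∷ [])

  -- N/x, i.e. the y with x y ≡ N; a junk value when x ≡ 0.
  cofactor : ℕ → ℕ
  cofactor x = search (inH N r x) r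

  cofactor-correct : ∀ {x} → ¬ x ≈ 0 → cofactor x < r × x * cofactor x ≈ N
  cofactor-correct {x} x≉0 with u , ux≈1 ← invertible x≉0 =
    map₂ (≡ᵇ⇒≡ _ _) (search-correct (inH N r x) (m%n<n (u * N) r) (≡⇒≡ᵇ _ _ x[uN]≈N))
    where
    open ≡-Reasoning
    x[uN]≈N : x * ((u * N) % r) ≈ N
    x[uN]≈N = begin
      (x * ((u * N) % r)) % r   ≡⟨ *-cong {x} refl (%-≈ (u * N)) ⟩
      (x * (u * N)) % r         ≡⟨ ≡⇒≈ (sym (*-assoc x u N)) ⟩
      (x * u * N) % r           ≡⟨ *-cong (trans (≡⇒≈ (*-comm x u)) ux≈1) refl ⟩
      (1 * N) % r               ≡⟨ ≡⇒≈ (*-identityˡ N) ⟩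
      N % r                     ∎

  factor≉0 : ∀ {x y} → x * y ≈ N → ¬ x ≈ 0
  factor≉0 {x} xy≈N x≈0 = N≉0 (trans (sym xy≈N) (*-cong {x} {0} x≈0 refl))

  cofactor-unique : ∀ {x y y′} → x * y ≈ N → x * y′ ≈ N → y ≈ y′
  cofactor-unique {x} xy≈N xy′≈N =
    [ ⊥-elim ∘ factor≉0 xy≈N , id ]′ (*-cancelˡ-≈ x (trans xy≈N (sym xy′≈N)))

  σ : ℕ → ℕ
  σ x = (kinv * cofactor x) % r

  g : ℕ → ℕ
  g x = (k * x + cofactor x) % r

  module _ {a : ℕ} (a≉0 : ¬ a ≈ 0) where

    a*cofactor≈N : a * cofactor a ≈ N
    a*cofactor≈N = proj₂ (cofactor-correct a≉0)

    a*σa≈c : a * σ a ≈ c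
    a*σa≈c = begin
      (a * σ a) % r                    ≡⟨ *-cong {a} refl (%-≈ _) ⟩
      (a * (kinv * cofactor a)) % r    ≡⟨ ≡⇒≈ (swap a kinv (cofactor a)) ⟩
      (kinv * (a * cofactor a)) % r    ≡⟨ *-cong {kinv} refl a*cofactor≈N ⟩
      c % r                            ∎
      where
      open ≡-Reasoning
      swap : ∀ a b c → a * (b * c) ≡ b * (a * c)
      swap a b c = solve (a ∷ b ∷ c ∷ [])

    σa≉0 : ¬ σ a ≈ 0
    σa≉0 σa≈0 = c≉0 (trans (sym a*σa≈c) (trans (*-cong {a} refl σa≈0) (≡⇒≈ (*-zeroʳ a))))

    cofactor-σ : cofactor (σ a) ≡ (k * a) % r
    cofactor-σ = ≈⇒≡ (proj₁ (cofactor-correct σa≉0)) (m%n<n (k * a) r)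
      (cofactor-unique {σ a} (proj₂ (cofactor-correct σa≉0)) σa*ka≈N)
      where
      open ≡-Reasoning
      σa*ka≈N : σ a * ((k * a) % r) ≈ N
      σa*ka≈N = begin
        (σ a * ((k * a) % r)) % r              ≡⟨ *-cong (%-≈ _) (%-≈ _) ⟩
        (kinv * cofactor a * (k * a)) % r      ≡⟨ ≡⇒≈ (rearrange (cofactor a)) ⟩
        (k * (kinv * (a * cofactor a))) % r    ≡⟨ k*[kinv*x]≈x _ ⟩
        (a * cofactor a) % r                   ≡⟨ a*cofactor≈N ⟩
        N % r                                  ∎
        where
        rearrange : ∀ y → kinv * y * (k * a) ≡ k * (kinv * (a * y))
        rearrange y = solve (kinv ∷ y ∷ k ∷ a ∷ [])

    σ-involutive : a < r → σ (σ a) ≡ a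
    σ-involutive a<r = ≈⇒≡ (m%n<n _ r) a<r (begin
      σ (σ a) % r                      ≡⟨ %-≈ _ ⟩
      (kinv * cofactor (σ a)) % r      ≡⟨ ≡⇒≈ (cong (_*_ kinv) cofactor-σ) ⟩
      (kinv * ((k * a) % r)) % r       ≡⟨ *-cong {kinv} refl (%-≈ _) ⟩
      (kinv * (k * a)) % r             ≡⟨ kinv*[k*x]≈x a ⟩
      a % r                            ∎)
      where open ≡-Reasoning

    g∘σ : g (σ a) ≡ g a
    g∘σ = begin
      (k * σ a + cofactor (σ a)) % r              ≡⟨ +-cong (*-cong {k} refl (%-≈ _)) (≡⇒≈ cofactor-σ) ⟩
      (k * (kinv * cofactor a) + (k * a) % r) % r ≡⟨ +-cong (k*[kinv*x]≈x _) (%-≈ _) ⟩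
      (cofactor a + k * a) % r                    ≡⟨ ≡⇒≈ (+-comm (cofactor a) (k * a)) ⟩
      (k * a + cofactor a) % r                    ∎
      where open ≡-Reasoning

  -- Multiplying g a ≡ g b by b clears the division in (a − b)(k − N/(a b)) ≡ 0.
  g-fibre : ∀ {a b} → a < r → b < r → ¬ a ≈ 0 → ¬ b ≈ 0 → g a ≡ g b → b ≡ a ⊎ b ≡ σ a
  g-fibre {a} {b} a<r b<r a≉0 b≉0 ga≡gb =
    Sum.map (sym ∘ ≈⇒≡ a<r b<r) (≈⇒≡ b<r (m%n<n _ r) ∘ b≈σa)
            (ac+bd≈ad+bc⇒a≈b⊎c≈d a b (k * b) (cofactor a) cross)
    where
    open ≡-Reasoning
    expand : ∀ y → a * (k * b) + b * y ≡ b * (k * a + y)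
    expand y = solve (a ∷ k ∷ b ∷ y ∷ [])
    b*cofactor≈a*cofactor : b * cofactor b ≈ a * cofactor a
    b*cofactor≈a*cofactor = trans (a*cofactor≈N b≉0) (sym (a*cofactor≈N a≉0))
    cross : a * (k * b) + b * cofactor a ≈ a * cofactor a + b * (k * b)
    cross = begin
      (a * (k * b) + b * cofactor a) % r   ≡⟨ ≡⇒≈ (expand (cofactor a)) ⟩
      (b * (k * a + cofactor a)) % r       ≡⟨ *-cong {b} refl ga≡gb ⟩
      (b * (k * b + cofactor b)) % r       ≡⟨ ≡⇒≈ (*-distribˡ-+ b (k * b) (cofactor b)) ⟩
      (b * (k * b) + b * cofactor b) % r   ≡⟨ +-cong {b * (k * b)} refl b*cofactor≈a*cofactor ⟩
      (b * (k * b) + a * cofactor a) % r   ≡⟨ ≡⇒≈ (+-comm (b * (k * b)) (a * cofactor a)) ⟩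
      (a * cofactor a + b * (k * b)) % r   ∎
    b≈σa : k * b ≈ cofactor a → b ≈ σ a
    b≈σa kb≈ya = sym (begin
      σ a % r                      ≡⟨ %-≈ _ ⟩
      (kinv * cofactor a) % r      ≡⟨ *-cong {kinv} refl (sym kb≈ya) ⟩
      (kinv * (k * b)) % r         ≡⟨ kinv*[k*x]≈x b ⟩
      b % r                        ∎)

  open Orbits r r σ g

  isOrbitPartition : IsOrbitPartition nonzero
  isOrbitPartition = record
    { σ-<          = λ _ _ → m%n<n _ r
    ; σ-closed     = λ a<r → nonzero⁺ ∘ σa≉0 ∘ nonzero⁻ a<r
    ; σ-involutive = λ a<r nz → σ-involutive (nonzero⁻ a<r nz) a<r
    ; g-<          = λ _ _ → m%n<n _ r
    ; g∘σ          = λ a<r nz → g∘σ (nonzero⁻ a<r nz)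
    ; g-fibre      = λ a<r b<r nza nzb → g-fibre a<r b<r (nonzero⁻ a<r nza) (nonzero⁻ b<r nzb)
    }

  inL≡image : ∀ {z} → inL N r k z ≡ image nonzero z
  inL≡image {z} = T-injective to from
    where
    to : T (inL N r k z) → T (image nonzero z)
    to t with x , x<r , t′ ← any-upTo⁻ _ t with y , y<r , t″ ← any-upTo⁻ _ t′
         with xy , gz ← Equivalence.to T-∧ t″ = image⁺ nonzero x<r (nonzero⁺ x≉0) gx≡z
      where
      xy≈N : x * y ≈ N
      xy≈N = ≡ᵇ⇒≡ _ _ xy
      x≉0 : ¬ x ≈ 0
      x≉0 = factor≉0 xy≈N
      y≡cofactor : y ≡ cofactor x
      y≡cofactor = ≈⇒≡ y<r (proj₁ (cofactor-correct x≉0))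
                       (cofactor-unique {x} xy≈N (proj₂ (cofactor-correct x≉0)))
      gx≡z : g x ≡ z
      gx≡z = trans (cong (λ y → (k * x + y) % r) (sym y≡cofactor)) (≡ᵇ⇒≡ _ _ gz)
    from : T (image nonzero z) → T (inL N r k z)
    from t with a , a<r , nz , ga≡z ← image⁻ nonzero t
           with cofactor<r , a*cofactor≈N ← cofactor-correct (nonzero⁻ a<r nz) =
      any-upTo⁺ _ a<r (any-upTo⁺ _ cofactor<r
        (Equivalence.from T-∧ (≡⇒≡ᵇ _ _ a*cofactor≈N , ≡⇒≡ᵇ _ _ ga≡z)))

  fixed≡root : ∀ {x} → x < r → fixed nonzero x ≡ ((x * x) % r ≡ᵇ c % r)
  fixed≡root {x} x<r = T-injective to from
    where
    to : T (fixed nonzero x) → T ((x * x) % r ≡ᵇ c % r)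
    to t with nz , σx≡x ← fixed⁻ nonzero t =
      ≡⇒≡ᵇ _ _ (trans (≡⇒≈ (cong (_*_ x) (sym σx≡x))) (a*σa≈c (nonzero⁻ x<r nz)))
    from : T ((x * x) % r ≡ᵇ c % r) → T (fixed nonzero x)
    from t = fixed⁺ nonzero (nonzero⁺ x≉0) (≈⇒≡ (m%n<n _ r) x<r σx≈x)
      where
      xx≈c : x * x ≈ c
      xx≈c = ≡ᵇ⇒≡ _ _ t
      x≉0 : ¬ x ≈ 0
      x≉0 x≈0 = c≉0 (trans (sym xx≈c) (*-cong {x} {0} x≈0 refl))
      σx≈x : σ x ≈ x
      σx≈x = [ ⊥-elim ∘ x≉0 , id ]′ (*-cancelˡ-≈ x (trans (a*σa≈c x≉0) (sym xx≈c)))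

  twice-cardL : 2 * cardL N r k ≡ pred r + count (λ x → (x * x) % r ≡ᵇ c % r) r
  twice-cardL = begin
    2 * cardL N r k                             ≡⟨ cong (2 *_) cardL≡count-image ⟩
    2 * count (image nonzero) r                 ≡⟨ orbit-count isOrbitPartition ⟩
    count nonzero r + count (fixed nonzero) r   ≡⟨ cong₂ _+_ count-nonzero-r (count-cong r fixed≡root) ⟩
    pred r + count (λ x → (x * x) % r ≡ᵇ c % r) r ∎
    where
    open ≡-Reasoning
    cardL≡count-image : cardL N r k ≡ count (image nonzero) r
    cardL≡count-image = trans (length-filterᵇ-upTo _ r) (count-cong r λ _ → inL≡image)
    count-nonzero-r : count nonzero r ≡ pred r
    count-nonzero-r = trans (cong (count nonzero) (sym (suc-pred r))) (count-nonzero (pred r))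

lemma3p4 : (N k r : ℕ) .{{_ : NonZero r}} → Prime r → ¬ (r ≡ 2) → Coprime (N * k) r →
    (kinv : ℕ) → (k * kinv) % r ≡ 1 →
    (+ 2) *ℤ (+ cardL N r k) ≡ (+ r) +ℤ legendre (kinv * N) r
lemma3p4 N k r r-prime r≢2 Nk-coprime kinv k*kinv≡1 = begin
  + 2 *ℤ + cardL N r k                    ≡⟨ sym (pos-* 2 (cardL N r k)) ⟩
  + (2 * cardL N r k)                     ≡⟨ cong +_ twice-cardL ⟩
  + (pred r + roots)                      ≡⟨ pos-+ (pred r) roots ⟩
  + pred r +ℤ + roots                     ≡⟨ cong (_+ℤ_ (+ pred r)) (root-count r≢2 c≉0) ⟩
  + pred r +ℤ (+ 1 +ℤ legendre c r)       ≡⟨ sym (ℤ.+-assoc (+ pred r) (+ 1) (legendre c r)) ⟩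
  + pred r +ℤ + 1 +ℤ legendre c r         ≡⟨ cong (_+ℤ legendre c r) pred-r+1 ⟩
  + r +ℤ legendre c r                     ∎
  where
  open ≡-Reasoning
  open PrimeResidues r r-prime using (root-count)
  open Hyperbola N k r kinv r-prime Nk-coprime k*kinv≡1 using (c; c≉0; twice-cardL)
  pred-r+1 : + pred r +ℤ + 1 ≡ + r
  pred-r+1 = trans (sym (pos-+ (pred r) 1)) (cong +_ (trans (+-comm (pred r) 1) (suc-pred r)))
  roots : ℕ
  roots = count (λ x → (x * x) % r ≡ᵇ c % r) r
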